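{- For any non-negative integers $k,l,m$ with $k+l+m\ge 1$, the Toeplitz graph $G_n(0^k1^l0^m)$ is word-representable for every positive integer $n$.
   Context: For a word $a_1a_2\cdots a_p$ over $\{0,1\}$, the Toeplitz graph $G_n(a_1a_2\cdots a_p)$ is the simple graph on vertex set $[n]=\{1,\dots,n\}$ in which distinct vertices $x,y$ are adjacent if and only if $a_r=1$, where $r\in[p]$ is such that $r\equiv |x-y|\pmod p$. (Equivalently it is the Riordan graph $G_n\big(\frac{a_1+a_2z+\cdots+a_pz^{p-1}}{1-z^p},z\big)$.) For a letter $c$, $c^j$ denotes $c$ repeated $j$ times, so $0^k1^l0^m$ is the word of length $k+l+m$ consisting of $k$ zeros, then $l$ ones, then $m$ zeros. Two distinct letters $x,y$ alternate in a word $w$ if deleting all other letters from $w$ yields a word of the form $xyxy\cdots$ or $yxyx\cdots$ (of even or odd length). A graph $G=(V,E)$ is word-representable if there is a word $w$ over the alphabet $V$ such that for all distinct $x,y\in V$, $x$ and $y$ alternate in $w$ if and only if $xy\in E$. -}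

module Defs where

open import Data.Bool using (Bool; true; false; T; _∧_; not; _∨_)
open import Data.Nat using (ℕ; _+_; _∸_; _≤_; _<_; _<ᵇ_; ∣_-_∣; >-nonZero)
open import Data.Nat.DivMod using (_%_; m%n<n)
open import Data.Fin using (Fin; toℕ; fromℕ<)
open import Data.Fin.Properties using (_≟_)
open import Data.List using (List; filter)
open import Data.List.Relation.Unary.Linked using (Linked)
open import Data.Product using (Σ)
open import Data.Sum using (_⊎_)
open import Function.Bundles using (_⇔_)
open import Relation.Nullary using (¬_)
open import Relation.Nullary.Decidable using (_⊎-dec_)
open import Relation.Binary.PropositionalEquality using (_≡_)

-- A (simple) graph on vertex set Fin n (vertex i ↔ i+1 ∈ [n]),
-- given by an adjacency relation (only consulted on distinct vertices).
Graph : ℕ → Set₁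
Graph n = Fin n → Fin n → Set

-- Toeplitz graph G_n(a_1 ⋯ a_p), the word given as a : Fin p → Bool
-- (a (i) = a_{i+1}).  For distinct x, y with d = |x - y| ≥ 1, the index
-- r ∈ [p] with r ≡ d (mod p) is r = ((d - 1) mod p) + 1, i.e. 0-based
-- index (d - 1) mod p.
toeplitz : (p : ℕ) → 1 ≤ p → (Fin p → Bool) → (n : ℕ) → Graph n
toeplitz p p≥1 a n x y =
  T (a (fromℕ< (m%n<n (∣ toℕ x - toℕ y ∣ ∸ 1) p {{>-nonZero p≥1}})))

block : (k l m : ℕ) → Fin (k + l + m) → Bool
block k l m i = (k Data.Nat.≤ᵇ toℕ i) ∧ (toℕ i <ᵇ k + l)
  where open import Data.Nat using (_≤ᵇ_)

-- x and y alternate in w: deleting all other letters gives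
-- xyxy⋯ or yxyx⋯ (any length), i.e. no two consecutive letters equal.
Alternate : {n : ℕ} → List (Fin n) → Fin n → Fin n → Set
Alternate w x y =
  Linked (λ u v → ¬ u ≡ v) (filter (λ z → (z ≟ x) ⊎-dec (z ≟ y)) w)

WordRepresentable : {n : ℕ} → Graph n → Set
WordRepresentable {n} G =
  Σ (List (Fin n)) λ w → ∀ (x y : Fin n) → ¬ x ≡ y → (Alternate w x y ⇔ G x y)

-- Write p = k + l + m and, for vertices x < y, let δ ∈ [1, p] be y − x reduced modulo p
-- into [1, p]; then x and y are adjacent in G_n(0^k 1^l 0^m) iff k < δ ≤ k + l.
--
-- The representing words are concatenations of p cells.  In cell r the vertex v has slot
-- (v + r) mod p; for a threshold α the cell lists, for each slot s < α in turn, the vertices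
-- of slot s in decreasing order, followed by every vertex of slot 0 or of slot ≥ α, in
-- increasing (↑) or decreasing (↓) order.  Restrict to a pair x < y and let u be the slot of
-- x.  If δ < α (for ↑), respectively p < α + δ (for ↓), every cell is an alternating word
-- whose first and last letters depend on u only, and as u steps cyclically through the
-- residues the last letter of a cell always differs from the first letter of the next.
-- Otherwise the cell in which x (for ↑), respectively y (for ↓), has slot 0 contains two
-- equal adjacent letters.  Hence the ↑-word for α = k + l + 1 followed by the ↓-word for
-- α = l + m represents the graph; if m = 0 or l = m = 0 a single word suffices.

module Submission where

open import Defs
open import Data.Bool using (T; true; false; if_then_else_)
open import Data.Bool.Properties using (T-∧; ∨-comm)
open import Data.Empty using (⊥-elim)
open import Data.Fin using (Fin; zero; suc; toℕ; fromℕ<)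
open import Data.Fin.Properties using (_≟_; toℕ-fromℕ<; toℕ-injective)
open import Data.List
  using (List; []; _∷_; _++_; [_]; _∷ʳ_; concatMap; map; foldr; filter; reverse; upTo; downFrom; tabulate; allFin)
open import Data.List.Properties
  using ( filter-++; filter-accept; filter-reject; filter-none; unfold-reverse; ++-identityʳ
        ; concatMap-++; concatMap-cong; upTo-∷ʳ; map-tabulate)
import Data.List.Relation.Unary.All as All
open import Data.List.Relation.Unary.Linked using (Linked; []; [-]; _∷_)
open import Data.Nat
  using (ℕ; zero; suc; pred; _+_; _∸_; _≤_; _<_; z≤n; s≤s; _≤?_; _<?_; ∣_-_∣; _%_; NonZero; >-nonZero)
open import Data.Nat.DivMod
  using (%-distribˡ-+; m%n%n≡m%n; m%n<n; m%n≤n; n%n≡0; [m+n]%n≡m%n; m<n⇒m%n≡m)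
open import Data.Nat.Properties
  using ( ≤-refl; ≤-trans; <-trans; <-irrefl; <-asym; ≤-<-trans; <-≤-trans; <-cmp; <⇒≤; <⇒≢; <⇒≱
        ; ≰⇒>; ≮⇒≥; ≤-pred; ≤∧≢⇒<; m≤n⇒m<n∨m≡n; m<n⇒m<1+n; 1+n≢0
        ; +-comm; +-assoc; +-suc; +-identityʳ; +-commutativeSemigroup; m<m+n; m+[n∸m]≡n; m∸n+n≡m
        ; +-monoˡ-≤; +-monoʳ-≤; +-monoˡ-<; +-mono-<-≤; +-cancelʳ-≤; +-cancelʳ-<; suc-pred; m<n⇒0<n∸m
        ; ∣-∣-comm; m≤n⇒∣m-n∣≡n∸m; ≤ᵇ⇒≤; ≤⇒≤ᵇ; <ᵇ⇒<; <⇒<ᵇ)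
  renaming (_≟_ to _≟ℕ_)
open import Algebra.Properties.CommutativeSemigroup +-commutativeSemigroup using (x∙yz≈xz∙y; xy∙z≈xz∙y)
open import Data.Product using (_×_; _,_; ∃-syntax)
open import Data.Sum using (_⊎_; inj₁; inj₂; [_,_]′)
open import Function using (_∘_; id)
open import Function.Bundles using (_⇔_; mk⇔; Equivalence)
open import Function.Construct.Composition using (_⇔-∘_)
open import Function.Construct.Symmetry using (⇔-sym)
open import Relation.Binary.Definitions using (DecidableEquality; tri<; tri≈; tri>)
open import Relation.Binary.PropositionalEquality
  using (_≡_; _≢_; _≗_; refl; sym; trans; cong; cong₂; subst; subst₂; module ≡-Reasoning)
open import Relation.Nullary using (¬_; Dec; yes; no; does)
open import Relation.Nullary.Decidable using (decidable-stable; dec-true; dec-false; _⊎-dec_; _×-dec_)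
open import Relation.Unary using (Pred; Decidable)

module _ {A : Set} {ℓ} {P : Pred A ℓ} (P? : Decidable P) where

  filter-does-cong : ∀ {Q : Pred A ℓ} (Q? : Decidable Q) → (∀ z → does (P? z) ≡ does (Q? z)) →
                     filter P? ≗ filter Q?
  filter-does-cong Q? eq []       = refl
  filter-does-cong Q? eq (z ∷ zs) with does (P? z) | does (Q? z) | eq z
  ... | true  | true  | refl = cong (z ∷_) (filter-does-cong Q? eq zs)
  ... | false | false | refl = filter-does-cong Q? eq zs

  filter-comm : ∀ {Q : Pred A ℓ} (Q? : Decidable Q) → filter P? ∘ filter Q? ≗ filter Q? ∘ filter P?
  filter-comm Q? []       = refl
  filter-comm Q? (z ∷ zs) with Q? z | P? z
  ... | yes qz | yes pz = trans (filter-accept P? pz)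
                                (trans (cong (z ∷_) (filter-comm Q? zs)) (sym (filter-accept Q? qz)))
  ... | yes _  | no ¬pz = trans (filter-reject P? ¬pz) (filter-comm Q? zs)
  ... | no ¬qz | yes _  = trans (filter-comm Q? zs) (sym (filter-reject Q? ¬qz))
  ... | no _   | no _   = filter-comm Q? zs

  filter-concatMap : ∀ {B : Set} (f : B → List A) xs → filter P? (concatMap f xs) ≡ concatMap (filter P? ∘ f) xs
  filter-concatMap f []       = refl
  filter-concatMap f (z ∷ zs) =
    trans (filter-++ P? (f z) (concatMap f zs)) (cong (filter P? (f z) ++_) (filter-concatMap f zs))

  filter-reverse : ∀ xs → filter P? (reverse xs) ≡ reverse (filter P? xs)
  filter-reverse []       = refl
  filter-reverse (z ∷ zs) = begin
    filter P? (reverse (z ∷ zs))              ≡⟨ cong (filter P?) (unfold-reverse z zs) ⟩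
    filter P? (reverse zs ∷ʳ z)               ≡⟨ filter-++ P? (reverse zs) [ z ] ⟩
    filter P? (reverse zs) ++ filter P? [ z ] ≡⟨ cong (_++ filter P? [ z ]) (filter-reverse zs) ⟩
    reverse (filter P? zs) ++ filter P? [ z ] ≡⟨ last-step ⟩
    reverse (filter P? (z ∷ zs))              ∎
    where
    open ≡-Reasoning
    last-step : reverse (filter P? zs) ++ filter P? [ z ] ≡ reverse (filter P? (z ∷ zs))
    last-step with P? z
    ... | yes _ = sym (unfold-reverse z (filter P? zs))
    ... | no _  = ++-identityʳ (reverse (filter P? zs))

  filter-map : ∀ {B : Set} (f : B → A) xs → filter P? (map f xs) ≡ map f (filter (P? ∘ f) xs)
  filter-map f []       = refl
  filter-map f (z ∷ zs) with does (P? (f z))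
  ... | true  = cong (f z ∷_) (filter-map f zs)
  ... | false = filter-map f zs

module _ {A : Set} (f : ℕ → List A) where

  concatMap-upTo-suc : ∀ n → concatMap f (upTo (suc n)) ≡ concatMap f (upTo n) ++ f n
  concatMap-upTo-suc n = begin
    concatMap f (upTo (suc n))          ≡⟨ cong (concatMap f) (sym (upTo-∷ʳ n)) ⟩
    concatMap f (upTo n ++ [ n ])       ≡⟨ concatMap-++ f (upTo n) [ n ] ⟩
    concatMap f (upTo n) ++ f n ++ []   ≡⟨ cong (concatMap f (upTo n) ++_) (++-identityʳ (f n)) ⟩
    concatMap f (upTo n) ++ f n         ∎
    where open ≡-Reasoning

  concatMap-upTo-none : ∀ n → (∀ i → i < n → f i ≡ []) → concatMap f (upTo n) ≡ []
  concatMap-upTo-none zero    _    = refl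
  concatMap-upTo-none (suc n) f≡[] = trans (concatMap-upTo-suc n)
    (cong₂ _++_ (concatMap-upTo-none n λ i i<n → f≡[] i (m<n⇒m<1+n i<n)) (f≡[] n ≤-refl))

  concatMap-upTo-one : ∀ {c} n → c < n → (∀ i → i < n → i ≢ c → f i ≡ []) →
                       concatMap f (upTo n) ≡ f c
  concatMap-upTo-one {c} (suc n) c<1+n f≡[] with n ≟ℕ c
  ... | yes refl = trans (concatMap-upTo-suc n) (cong (_++ f n)
                     (concatMap-upTo-none n λ i i<n → f≡[] i (m<n⇒m<1+n i<n) λ { refl → <-irrefl refl i<n }))
  ... | no n≢c   = trans (concatMap-upTo-suc n) (trans
                     (cong₂ _++_ (concatMap-upTo-one n c<n λ i i<n → f≡[] i (m<n⇒m<1+n i<n))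
                                 (f≡[] n ≤-refl n≢c))
                     (++-identityʳ (f c)))
    where c<n = ≤∧≢⇒< (≤-pred c<1+n) (n≢c ∘ sym)

  concatMap-upTo-two : ∀ {c d} n → c < d → d < n → (∀ i → i < n → i ≢ c → i ≢ d → f i ≡ []) →
                       concatMap f (upTo n) ≡ f c ++ f d
  concatMap-upTo-two {c} {d} (suc n) c<d d<1+n f≡[] with n ≟ℕ d
  ... | yes refl = trans (concatMap-upTo-suc n) (cong (_++ f n)
                     (concatMap-upTo-one n c<d λ i i<n i≢c →
                       f≡[] i (m<n⇒m<1+n i<n) i≢c λ { refl → <-irrefl refl i<n }))
  ... | no n≢d   = trans (concatMap-upTo-suc n) (trans
                     (cong₂ _++_ (concatMap-upTo-two n c<d d<n λ i i<n → f≡[] i (m<n⇒m<1+n i<n))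
                                 (f≡[] n ≤-refl (λ { refl → <-irrefl refl (<-trans c<d d<n) }) n≢d))
                     (++-identityʳ (f c ++ f d)))
    where d<n = ≤∧≢⇒< (≤-pred d<1+n) (n≢d ∘ sym)

filter-allFin-suc : ∀ {n ℓ} {P : Pred (Fin (suc n)) ℓ} (P? : Decidable P) →
                    filter P? (allFin (suc n)) ≡ filter P? [ zero ] ++ map suc (filter (P? ∘ suc) (allFin n))
filter-allFin-suc {n} P? = begin
  filter P? ([ zero ] ++ tabulate suc)                 ≡⟨ cong (λ zs → filter P? ([ zero ] ++ zs))
                                                                (sym (map-tabulate id suc)) ⟩
  filter P? ([ zero ] ++ map suc (allFin n))           ≡⟨ filter-++ P? [ zero ] (map suc (allFin n)) ⟩
  filter P? [ zero ] ++ filter P? (map suc (allFin n)) ≡⟨ cong (filter P? [ zero ] ++_)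
                                                                (filter-map P? suc (allFin n)) ⟩
  filter P? [ zero ] ++ map suc (filter (P? ∘ suc) (allFin n)) ∎
  where open ≡-Reasoning

-- The `λ _ → refl`s below hold because `does (suc z ≟ suc y)` computes to `does (z ≟ y)`.
filter-allFin-≟ : ∀ {n} (y : Fin n) → filter (_≟ y) (allFin n) ≡ [ y ]
filter-allFin-≟ {suc n} zero    = trans (filter-allFin-suc (_≟ zero)) (cong (λ zs → zero ∷ map suc zs)
  (filter-none ((_≟ zero) ∘ suc) (All.universal (λ _ ()) (allFin n))))
filter-allFin-≟ {suc n} (suc y) = trans (filter-allFin-suc (_≟ suc y)) (cong (map suc)
  (trans (filter-does-cong ((_≟ suc y) ∘ suc) (_≟ y) (λ _ → refl) (allFin n)) (filter-allFin-≟ y)))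

pair? : ∀ {n} (x y : Fin n) → Decidable (λ z → z ≡ x ⊎ z ≡ y)
pair? x y z = z ≟ x ⊎-dec z ≟ y

filter-allFin-pair : ∀ {n} {x y : Fin n} → toℕ x < toℕ y → filter (pair? x y) (allFin n) ≡ x ∷ y ∷ []
filter-allFin-pair {suc n} {zero}  {suc y} _         = trans (filter-allFin-suc (pair? zero (suc y)))
  (cong (λ zs → zero ∷ map suc zs)
        (trans (filter-does-cong (pair? zero (suc y) ∘ suc) (_≟ y) (λ _ → refl) (allFin n)) (filter-allFin-≟ y)))
filter-allFin-pair {suc n} {suc x} {suc y} (s≤s x<y) = trans (filter-allFin-suc (pair? (suc x) (suc y)))
  (cong (map suc)
        (trans (filter-does-cong (pair? (suc x) (suc y) ∘ suc) (pair? x y) (λ _ → refl) (allFin n))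
               (filter-allFin-pair x<y)))

m<n⇒m+o<o+n : ∀ {m n} o → m < n → m + o < o + n
m<n⇒m+o<o+n {m} {n} o m<n = subst (m + o <_) (+-comm n o) (+-monoˡ-< o m<n)

m≤n⇒o+m≤n+o : ∀ {m n} o → m ≤ n → o + m ≤ n + o
m≤n⇒o+m≤n+o {m} {n} o m≤n = subst (o + m ≤_) (+-comm o n) (+-monoʳ-≤ o m≤n)

module _ {d : ℕ} .{{_ : NonZero d}} where

  [m%d+n]%d≡[m+n]%d : ∀ m n → (m % d + n) % d ≡ (m + n) % d
  [m%d+n]%d≡[m+n]%d m n = begin
    (m % d + n) % d         ≡⟨ %-distribˡ-+ (m % d) n d ⟩
    (m % d % d + n % d) % d ≡⟨ cong (λ t → (t + n % d) % d) (m%n%n≡m%n m d) ⟩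
    (m % d + n % d) % d     ≡⟨ sym (%-distribˡ-+ m n d) ⟩
    (m + n) % d             ∎
    where open ≡-Reasoning

  [m+n%d]%d≡[m+n]%d : ∀ m n → (m + n % d) % d ≡ (m + n) % d
  [m+n%d]%d≡[m+n]%d m n = begin
    (m + n % d) % d ≡⟨ cong (_% d) (+-comm m (n % d)) ⟩
    (n % d + m) % d ≡⟨ [m%d+n]%d≡[m+n]%d n m ⟩
    (n + m) % d     ≡⟨ cong (_% d) (+-comm n m) ⟩
    (m + n) % d     ∎
    where open ≡-Reasoning

  m%d+d≡m : ∀ m → d ≤ m → m < d + d → m % d + d ≡ m
  m%d+d≡m m d≤m m<2d = begin
    m % d + d           ≡⟨ cong (λ t → t % d + d) (sym m∸d+d≡m) ⟩
    (m ∸ d + d) % d + d ≡⟨ cong (_+ d) ([m+n]%n≡m%n (m ∸ d) d) ⟩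
    (m ∸ d) % d + d     ≡⟨ cong (_+ d) (m<n⇒m%n≡m m∸d<d) ⟩
    m ∸ d + d           ≡⟨ m∸d+d≡m ⟩
    m                   ∎
    where
    open ≡-Reasoning
    m∸d+d≡m : m ∸ d + d ≡ m
    m∸d+d≡m = m∸n+n≡m d≤m
    m∸d<d : m ∸ d < d
    m∸d<d = +-cancelʳ-< d (m ∸ d) d (subst (_< d + d) (sym m∸d+d≡m) m<2d)

  ∃-complement-mod : ∀ m → ∃[ r ] r < d × (m + r) % d ≡ 0
  ∃-complement-mod m = (d ∸ m % d) % d , m%n<n (d ∸ m % d) d , (begin
    (m + (d ∸ m % d) % d) % d ≡⟨ [m+n%d]%d≡[m+n]%d m (d ∸ m % d) ⟩
    (m + (d ∸ m % d)) % d     ≡⟨ sym ([m%d+n]%d≡[m+n]%d m (d ∸ m % d)) ⟩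
    (m % d + (d ∸ m % d)) % d ≡⟨ cong (_% d) (m+[n∸m]≡n (m%n≤n m d)) ⟩
    d % d                     ≡⟨ n%n≡0 d ⟩
    0                         ∎)
    where open ≡-Reasoning

-- Alternation of words

-- What a word looks like as far as alternation is concerned: empty, with two equal adjacent
-- letters, or alternating from its first to its last letter.
data Ends (A : Set) : Set where
  ∅     : Ends A
  clash : Ends A
  _⋯_   : A → A → Ends A

module Alternation {A : Set} (_≟_ : DecidableEquality A) where

  glue : {b c : A} → A → A → Dec (b ≡ c) → Ends A
  glue a d (yes _) = clash
  glue a d (no _)  = a ⋯ d

  infixr 5 _⊕_
  _⊕_ : Ends A → Ends A → Ends A
  ∅       ⊕ t       = t
  clash   ⊕ _       = clash
  (a ⋯ b) ⊕ ∅       = a ⋯ b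
  (a ⋯ b) ⊕ clash   = clash
  (a ⋯ b) ⊕ (c ⋯ d) = glue a d (b ≟ c)

  ⊕-identityʳ : ∀ t → t ⊕ ∅ ≡ t
  ⊕-identityʳ ∅       = refl
  ⊕-identityʳ clash   = refl
  ⊕-identityʳ (a ⋯ b) = refl

  ⊕-zeroʳ : ∀ t → t ⊕ clash ≡ clash
  ⊕-zeroʳ ∅       = refl
  ⊕-zeroʳ clash   = refl
  ⊕-zeroʳ (a ⋯ b) = refl

  ⋯⊕⋯-≢ : ∀ {a b c d} → b ≢ c → (a ⋯ b) ⊕ (c ⋯ d) ≡ a ⋯ d
  ⋯⊕⋯-≢ {b = b} {c} b≢c with b ≟ c
  ... | yes b≡c = ⊥-elim (b≢c b≡c)
  ... | no _    = refl

  ⋯⊕⋯-≡ : ∀ {a b c d} → b ≡ c → (a ⋯ b) ⊕ (c ⋯ d) ≡ clash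
  ⋯⊕⋯-≡ {b = b} {c} b≡c with b ≟ c
  ... | yes _   = refl
  ... | no b≢c  = ⊥-elim (b≢c b≡c)

  ⊕-assoc : ∀ s t u → (s ⊕ t) ⊕ u ≡ s ⊕ (t ⊕ u)
  ⊕-assoc ∅       t       u       = refl
  ⊕-assoc clash   t       u       = refl
  ⊕-assoc (a ⋯ b) ∅       u       = refl
  ⊕-assoc (a ⋯ b) clash   u       = refl
  ⊕-assoc (a ⋯ b) (c ⋯ d) ∅       = ⊕-identityʳ ((a ⋯ b) ⊕ (c ⋯ d))
  ⊕-assoc (a ⋯ b) (c ⋯ d) clash   = ⊕-zeroʳ ((a ⋯ b) ⊕ (c ⋯ d))
  ⊕-assoc (a ⋯ b) (c ⋯ d) (e ⋯ f) with b ≟ c | d ≟ e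
  ... | yes _   | yes _   = refl
  ... | yes b≡c | no _    = sym (⋯⊕⋯-≡ b≡c)
  ... | no _    | yes d≡e = ⋯⊕⋯-≡ d≡e
  ... | no b≢c  | no d≢e  = trans (⋯⊕⋯-≢ d≢e) (sym (⋯⊕⋯-≢ b≢c))

  ends : List A → Ends A
  ends []       = ∅
  ends (a ∷ as) = (a ⋯ a) ⊕ ends as

  ends-++ : ∀ xs ys → ends (xs ++ ys) ≡ ends xs ⊕ ends ys
  ends-++ []       ys = refl
  ends-++ (a ∷ xs) ys =
    trans (cong ((a ⋯ a) ⊕_) (ends-++ xs ys)) (sym (⊕-assoc (a ⋯ a) (ends xs) (ends ys)))

  ⨁ : List (Ends A) → Ends A
  ⨁ = foldr _⊕_ ∅

  ends-concatMap : ∀ {B : Set} (g : B → List A) xs → ends (concatMap g xs) ≡ ⨁ (map (ends ∘ g) xs)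
  ends-concatMap g []       = refl
  ends-concatMap g (z ∷ zs) = trans (ends-++ (g z) (concatMap g zs)) (cong (ends (g z) ⊕_) (ends-concatMap g zs))

  ends-∷-≢ : ∀ {a b c} bs → a ≢ b → ends (b ∷ bs) ≡ b ⋯ c → ends (a ∷ b ∷ bs) ≡ a ⋯ c
  ends-∷-≢ {a} bs a≢b eq = trans (cong ((a ⋯ a) ⊕_) eq) (⋯⊕⋯-≢ a≢b)

  ends-∷-≡ : ∀ a bs → ends (a ∷ a ∷ bs) ≡ clash
  ends-∷-≡ a bs = trans (sym (⊕-assoc (a ⋯ a) (a ⋯ a) (ends bs))) (cong (_⊕ ends bs) (⋯⊕⋯-≡ refl))

  Alternating : List A → Set
  Alternating = Linked _≢_

  alternating⇒ends : ∀ {a} as → Alternating (a ∷ as) → ∃[ b ] ends (a ∷ as) ≡ a ⋯ b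
  alternating⇒ends {a} []       [-]         = a , refl
  alternating⇒ends     (_ ∷ bs) (a≢b ∷ alt) with alternating⇒ends bs alt
  ... | c , eq = c , ends-∷-≢ bs a≢b eq

  ends≢clash⇒alternating∷ : ∀ a as → ends (a ∷ as) ≢ clash → Alternating (a ∷ as)
  ends≢clash⇒alternating∷ a []       _       = [-]
  ends≢clash⇒alternating∷ a (b ∷ cs) ≢clash = a≢b ∷ alt
    where
    alt : Alternating (b ∷ cs)
    alt = ends≢clash⇒alternating∷ b cs λ eq → ≢clash (trans (cong ((a ⋯ a) ⊕_) eq) (⊕-zeroʳ (a ⋯ a)))
    a≢b : a ≢ b
    a≢b a≡b with alternating⇒ends cs alt
    ... | _ , eq = ≢clash (trans (cong ((a ⋯ a) ⊕_) eq) (⋯⊕⋯-≡ a≡b))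

  ends≢clash⇒alternating : ∀ xs → ends xs ≢ clash → Alternating xs
  ends≢clash⇒alternating []       _ = []
  ends≢clash⇒alternating (a ∷ as)   = ends≢clash⇒alternating∷ a as

  alternating⇒ends≢clash : ∀ xs → Alternating xs → ends xs ≢ clash
  alternating⇒ends≢clash []       _   ()
  alternating⇒ends≢clash (a ∷ as) alt eq with alternating⇒ends as alt
  ... | _ , eq′ with () ← trans (sym eq) eq′

  alternating⇔ : ∀ {P : Set} xs → Dec P →
                 (P → ∃[ a ] ∃[ b ] ends xs ≡ a ⋯ b) → (¬ P → ends xs ≡ clash) →
                 Alternating xs ⇔ P
  alternating⇔ xs P? P⇒⋯ ¬P⇒clash = mk⇔ to from
    where
    to : Alternating xs → _
    to alt = decidable-stable P? λ ¬p → alternating⇒ends≢clash xs alt (¬P⇒clash ¬p)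
    from : _ → Alternating xs
    from p with P⇒⋯ p
    ... | _ , _ , eq = ends≢clash⇒alternating xs λ eq′ → ⋯≢clash (trans (sym eq) eq′)
      where
      ⋯≢clash : ∀ {u v : A} → u ⋯ v ≢ clash
      ⋯≢clash ()

  ⨁-downFrom-⋯ : ∀ {S : ℕ → Ends A} {H L : ℕ → A} N →
                 (∀ r → S r ≡ H r ⋯ L r) → (∀ r → L (suc r) ≢ H r) →
                 ⨁ (map S (downFrom (suc N))) ≡ H N ⋯ L 0
  ⨁-downFrom-⋯ {S} zero    S≡ L≢H = trans (⊕-identityʳ (S 0)) (S≡ 0)
  ⨁-downFrom-⋯     (suc N) S≡ L≢H =
    trans (cong₂ _⊕_ (S≡ (suc N)) (⨁-downFrom-⋯ N S≡ L≢H)) (⋯⊕⋯-≢ (L≢H N))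

  ⨁-downFrom-clash : ∀ {S : ℕ → Ends A} {r} N → r < N → S r ≡ clash → ⨁ (map S (downFrom N)) ≡ clash
  ⨁-downFrom-clash {S} {r} (suc N) r<1+N Sr≡clash with r ≟ℕ N
  ... | yes refl = cong (_⊕ ⨁ (map S (downFrom N))) Sr≡clash
  ... | no r≢N   = trans (cong (S N ⊕_) (⨁-downFrom-clash N (≤∧≢⇒< (≤-pred r<1+N) r≢N) Sr≡clash))
                         (⊕-zeroʳ (S N))

-- The words

data Order : Set where
  ↑ ↓ : Order

module Construction (n p : ℕ) .{{_ : NonZero p}} where

  slot : ℕ → Fin n → ℕ
  slot r v = (toℕ v + r) % p

  sweep : Order → List (Fin n)
  sweep ↑ = allFin n
  sweep ↓ = reverse (allFin n)

  Swept : ℕ → ℕ → Set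
  Swept α s = s ≡ 0 ⊎ α ≤ s

  swept? : ∀ α s → Dec (Swept α s)
  swept? α s = s ≟ℕ 0 ⊎-dec α ≤? s

  slot? : ∀ r s → Decidable (λ v → slot r v ≡ s)
  slot? r s v = slot r v ≟ℕ s

  bucket : ℕ → ℕ → List (Fin n)
  bucket r s = filter (slot? r s) (sweep ↓)

  cell : ℕ → Order → ℕ → List (Fin n)
  cell α o r = concatMap (bucket r) (upTo α) ++ filter (swept? α ∘ slot r) (sweep o)

  word : ℕ → Order → List (Fin n)
  word α o = concatMap (cell α o) (downFrom p)

  slot-suc : ∀ r v → slot (suc r) v ≡ (slot r v + 1) % p
  slot-suc r v = begin
    (toℕ v + suc r) % p       ≡⟨ cong (_% p) (x∙yz≈xz∙y (toℕ v) 1 r) ⟩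
    (toℕ v + r + 1) % p       ≡⟨ sym ([m%d+n]%d≡[m+n]%d (toℕ v + r) 1) ⟩
    ((toℕ v + r) % p + 1) % p ∎
    where open ≡-Reasoning

  slot-zero : ∀ v → slot 0 v ≡ (slot (pred p) v + 1) % p
  slot-zero v = begin
    (toℕ v + 0) % p           ≡⟨ cong (_% p) (+-identityʳ (toℕ v)) ⟩
    toℕ v % p                 ≡⟨ sym ([m+n]%n≡m%n (toℕ v) p) ⟩
    (toℕ v + p) % p           ≡⟨ cong (λ t → (toℕ v + t) % p) (sym (suc-pred p)) ⟩
    slot (suc (pred p)) v     ≡⟨ slot-suc (pred p) v ⟩
    (slot (pred p) v + 1) % p ∎
    where open ≡-Reasoning

residue : (p : ℕ) .{{_ : NonZero p}} {n : ℕ} → Fin n → Fin n → ℕ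
residue p x y = (∣ toℕ x - toℕ y ∣ ∸ 1) % p

-- Restriction to a pair of vertices

module Pair {n p : ℕ} .{{_ : NonZero p}} {x y : Fin n} (x<y : toℕ x < toℕ y) where

  open Construction n p
  open Alternation (_≟_ {n})

  x≢y : x ≢ y
  x≢y x≡y = <-irrefl (cong toℕ x≡y) x<y

  y≢x : y ≢ x
  y≢x = x≢y ∘ sym

  restrict : List (Fin n) → List (Fin n)
  restrict = filter (pair? x y)

  ordered : Order → List (Fin n)
  ordered ↑ = x ∷ y ∷ []
  ordered ↓ = y ∷ x ∷ []

  restrict-sweep : ∀ o → restrict (sweep o) ≡ ordered o
  restrict-sweep ↑ = filter-allFin-pair x<y
  restrict-sweep ↓ = trans (filter-reverse (pair? x y) (allFin n)) (cong reverse (filter-allFin-pair x<y))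

  sx sy : ℕ → ℕ
  sx r = slot r x
  sy r = slot r y

  bucketPair : ℕ → ℕ → List (Fin n)
  bucketPair r s = filter (slot? r s) (y ∷ x ∷ [])

  buckets : ℕ → ℕ → List (Fin n)
  buckets α r = concatMap (bucketPair r) (upTo α)

  sweptPair : ℕ → Order → ℕ → List (Fin n)
  sweptPair α o r = filter (swept? α ∘ slot r) (ordered o)

  restrict-cell : ∀ α o r → restrict (cell α o r) ≡ buckets α r ++ sweptPair α o r
  restrict-cell α o r = begin
    restrict (concatMap (bucket r) (upTo α) ++ filter (swept? α ∘ slot r) (sweep o))
      ≡⟨ filter-++ (pair? x y) (concatMap (bucket r) (upTo α)) _ ⟩
    restrict (concatMap (bucket r) (upTo α)) ++ restrict (filter (swept? α ∘ slot r) (sweep o))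
      ≡⟨ cong₂ _++_ (trans (filter-concatMap (pair? x y) (bucket r) (upTo α))
                           (concatMap-cong restrict-bucket (upTo α)))
                    (trans (filter-comm (pair? x y) (swept? α ∘ slot r) (sweep o))
                           (cong (filter (swept? α ∘ slot r)) (restrict-sweep o))) ⟩
    buckets α r ++ sweptPair α o r
      ∎
    where
    open ≡-Reasoning
    restrict-bucket : ∀ s → restrict (bucket r s) ≡ bucketPair r s
    restrict-bucket s = trans (filter-comm (pair? x y) (slot? r s) (sweep ↓))
                              (cong (filter (slot? r s)) (restrict-sweep ↓))

  bucketPair-none : ∀ {r s} → s ≢ sx r → s ≢ sy r → bucketPair r s ≡ []
  bucketPair-none {r} {s} s≢u s≢v =
    trans (filter-reject (slot? r s) (s≢v ∘ sym)) (filter-reject (slot? r s) (s≢u ∘ sym))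

  bucketPair-x : ∀ {r} → sx r ≢ sy r → bucketPair r (sx r) ≡ [ x ]
  bucketPair-x {r} u≢v =
    trans (filter-reject (slot? r (sx r)) (u≢v ∘ sym)) (filter-accept (slot? r (sx r)) refl)

  bucketPair-y : ∀ {r} → sx r ≢ sy r → bucketPair r (sy r) ≡ [ y ]
  bucketPair-y {r} u≢v =
    trans (filter-accept (slot? r (sy r)) refl) (cong (y ∷_) (filter-reject (slot? r (sy r)) u≢v))

  bucketPair-tie : ∀ {r} → sx r ≡ sy r → bucketPair r (sx r) ≡ y ∷ x ∷ []
  bucketPair-tie {r} u≡v =
    trans (filter-accept (slot? r (sx r)) (sym u≡v)) (cong (y ∷_) (filter-accept (slot? r (sx r)) refl))

  unswept : ∀ {α s} → s ≢ 0 → s < α → ¬ Swept α s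
  unswept s≢0 _   (inj₁ s≡0) = s≢0 s≡0
  unswept _   s<α (inj₂ α≤s) = <⇒≱ s<α α≤s

  module _ {α r : ℕ} where

    buckets-none : α ≤ sx r → α ≤ sy r → buckets α r ≡ []
    buckets-none α≤u α≤v = concatMap-upTo-none (bucketPair r) α λ i i<α →
      bucketPair-none (λ { refl → <⇒≱ i<α α≤u }) (λ { refl → <⇒≱ i<α α≤v })

    buckets-x : sx r < α → α ≤ sy r → buckets α r ≡ [ x ]
    buckets-x u<α α≤v = trans
      (concatMap-upTo-one (bucketPair r) α u<α λ i i<α i≢u →
        bucketPair-none i≢u λ { refl → <⇒≱ i<α α≤v })
      (bucketPair-x λ u≡v → <⇒≱ u<α (subst (α ≤_) (sym u≡v) α≤v))

    buckets-y : sy r < α → α ≤ sx r → buckets α r ≡ [ y ]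
    buckets-y v<α α≤u = trans
      (concatMap-upTo-one (bucketPair r) α v<α λ i i<α i≢v →
        bucketPair-none (λ { refl → <⇒≱ i<α α≤u }) i≢v)
      (bucketPair-y λ u≡v → <⇒≱ v<α (subst (α ≤_) u≡v α≤u))

    buckets-xy : sx r < sy r → sy r < α → buckets α r ≡ x ∷ y ∷ []
    buckets-xy u<v v<α = trans
      (concatMap-upTo-two (bucketPair r) α u<v v<α λ i _ → bucketPair-none)
      (cong₂ _++_ (bucketPair-x u≢v) (bucketPair-y u≢v))
      where u≢v = <⇒≢ u<v

    buckets-yx : sy r ≤ sx r → sx r < α → buckets α r ≡ y ∷ x ∷ []
    buckets-yx v≤u u<α with m≤n⇒m<n∨m≡n v≤u
    ... | inj₁ v<u = trans
      (concatMap-upTo-two (bucketPair r) α v<u u<α λ i _ i≢v i≢u → bucketPair-none i≢u i≢v)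
      (cong₂ _++_ (bucketPair-y u≢v) (bucketPair-x u≢v))
      where u≢v = <⇒≢ v<u ∘ sym
    ... | inj₂ v≡u = trans
      (concatMap-upTo-one (bucketPair r) α u<α λ i _ i≢u →
        bucketPair-none i≢u (λ i≡v → i≢u (trans i≡v v≡u)))
      (bucketPair-tie (sym v≡u))

    sw? : Decidable (Swept α ∘ slot r)
    sw? = swept? α ∘ slot r

    swept-both : ∀ o → Swept α (sx r) → Swept α (sy r) → sweptPair α o r ≡ ordered o
    swept-both ↑ u∈ v∈ = trans (filter-accept sw? u∈) (cong (x ∷_) (filter-accept sw? v∈))
    swept-both ↓ u∈ v∈ = trans (filter-accept sw? v∈) (cong (y ∷_) (filter-accept sw? u∈))

    swept-x : ∀ o → Swept α (sx r) → ¬ Swept α (sy r) → sweptPair α o r ≡ [ x ]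
    swept-x ↑ u∈ v∉ = trans (filter-accept sw? u∈) (cong (x ∷_) (filter-reject sw? v∉))
    swept-x ↓ u∈ v∉ = trans (filter-reject sw? v∉) (filter-accept sw? u∈)

    swept-y : ∀ o → ¬ Swept α (sx r) → Swept α (sy r) → sweptPair α o r ≡ [ y ]
    swept-y ↑ u∉ v∈ = trans (filter-reject sw? u∉) (filter-accept sw? v∈)
    swept-y ↓ u∉ v∈ = trans (filter-accept sw? v∈) (cong (y ∷_) (filter-reject sw? u∉))

    swept-none : ∀ o → ¬ Swept α (sx r) → ¬ Swept α (sy r) → sweptPair α o r ≡ []
    swept-none ↑ u∉ v∉ = trans (filter-reject sw? u∉) (filter-reject sw? v∉)
    swept-none ↓ u∉ v∉ = trans (filter-reject sw? v∉) (filter-reject sw? u∉)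

  ends-xy : ends (x ∷ y ∷ []) ≡ x ⋯ y
  ends-xy = ends-∷-≢ [] x≢y refl

  ends-yx : ends (y ∷ x ∷ []) ≡ y ⋯ x
  ends-yx = ends-∷-≢ [] y≢x refl

  ends-xyx : ends (x ∷ y ∷ x ∷ []) ≡ x ⋯ x
  ends-xyx = ends-∷-≢ [ x ] x≢y ends-yx

  ends-yxy : ends (y ∷ x ∷ y ∷ []) ≡ y ⋯ y
  ends-yxy = ends-∷-≢ [ y ] y≢x ends-xy

  ends-yxyx : ends (y ∷ x ∷ y ∷ x ∷ []) ≡ y ⋯ x
  ends-yxyx = ends-∷-≢ (y ∷ x ∷ []) y≢x (ends-∷-≢ [ x ] x≢y ends-yx)

  ends-yxxy : ends (y ∷ x ∷ x ∷ y ∷ []) ≡ clash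
  ends-yxxy = trans (cong ((y ⋯ y) ⊕_) (ends-∷-≡ x [ y ])) (⊕-zeroʳ (y ⋯ y))

  -- y − x reduced modulo p into [1, p]
  δ : ℕ
  δ = suc (residue p x y)

  δ≤p : δ ≤ p
  δ≤p = m%n<n _ p

  slot-y : ∀ r → sy r ≡ (sx r + δ) % p
  slot-y r = sym (begin
    (sx r + δ) % p                ≡⟨ [m%d+n]%d≡[m+n]%d (toℕ x + r) δ ⟩
    (toℕ x + r + (1 + e % p)) % p ≡⟨ cong (_% p) (sym (+-assoc (toℕ x + r) 1 (e % p))) ⟩
    (toℕ x + r + 1 + e % p) % p   ≡⟨ [m+n%d]%d≡[m+n]%d (toℕ x + r + 1) e ⟩
    (toℕ x + r + 1 + e) % p       ≡⟨ cong (_% p) (+-assoc (toℕ x + r) 1 e) ⟩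
    (toℕ x + r + suc e) % p       ≡⟨ cong (_% p) (xy∙z≈xz∙y (toℕ x) r (suc e)) ⟩
    (toℕ x + suc e + r) % p       ≡⟨ cong (λ t → (t + r) % p) x+1+e≡y ⟩
    (toℕ y + r) % p               ∎)
    where
    open ≡-Reasoning
    e = ∣ toℕ x - toℕ y ∣ ∸ 1
    distance≡y∸x = m≤n⇒∣m-n∣≡n∸m (<⇒≤ x<y)
    x+1+e≡y : toℕ x + suc e ≡ toℕ y
    x+1+e≡y = begin
      toℕ x + suc e             ≡⟨ cong (toℕ x +_) (m+[n∸m]≡n (subst (1 ≤_) (sym distance≡y∸x)
                                                                     (m<n⇒0<n∸m x<y))) ⟩
      toℕ x + ∣ toℕ x - toℕ y ∣ ≡⟨ cong (toℕ x +_) distance≡y∸x ⟩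
      toℕ x + (toℕ y ∸ toℕ x)   ≡⟨ m+[n∸m]≡n (<⇒≤ x<y) ⟩
      toℕ y                     ∎

  data Wrap (u v : ℕ) : Set where
    below : u + δ < p → v ≡ u + δ     → Wrap u v
    at    : u + δ ≡ p → v ≡ 0         → Wrap u v
    above : p < u + δ → v + p ≡ u + δ → Wrap u v

  wrap : ∀ r → Wrap (sx r) (sy r)
  wrap r with <-cmp (sx r + δ) p
  ... | tri< lt _ _ = below lt (trans (slot-y r) (m<n⇒m%n≡m lt))
  ... | tri≈ _ eq _ = at eq (trans (slot-y r) (trans (cong (_% p) eq) (n%n≡0 p)))
  ... | tri> _ _ gt = above gt (trans (cong (_+ p) (slot-y r)) (m%d+d≡m (sx r + δ) (<⇒≤ gt) u+δ<2p))
    where u+δ<2p = +-mono-<-≤ (m%n<n (toℕ x + r) p) δ≤p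

  -- The first and last letter of the restriction of a cell in which x has slot u.
  entry : ℕ → Fin n
  entry u = if does (u + δ <? p) then x else y

  exit : ℕ → Fin n
  exit u = if does (u ≟ℕ 0 ⊎-dec p <? u + δ) then x else y

  entry-below : ∀ {u} → u + δ < p → entry u ≡ x
  entry-below {u} lt = cong (if_then x else y) (dec-true (u + δ <? p) lt)

  entry-≮ : ∀ {u} → ¬ u + δ < p → entry u ≡ y
  entry-≮ {u} ≮ = cong (if_then x else y) (dec-false (u + δ <? p) ≮)

  entry-at : ∀ {u} → u + δ ≡ p → entry u ≡ y
  entry-at eq = entry-≮ (<-irrefl eq)

  entry-above : ∀ {u} → p < u + δ → entry u ≡ y
  entry-above gt = entry-≮ (<-asym gt)

  exit-zero : ∀ {u} → u ≡ 0 → exit u ≡ x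
  exit-zero {u} u≡0 = cong (if_then x else y) (dec-true (u ≟ℕ 0 ⊎-dec p <? u + δ) (inj₁ u≡0))

  exit-above : ∀ {u} → p < u + δ → exit u ≡ x
  exit-above {u} gt = cong (if_then x else y) (dec-true (u ≟ℕ 0 ⊎-dec p <? u + δ) (inj₂ gt))

  exit-≯ : ∀ {u} → u ≢ 0 → ¬ p < u + δ → exit u ≡ y
  exit-≯ {u} u≢0 ≯ = cong (if_then x else y) (dec-false (u ≟ℕ 0 ⊎-dec p <? u + δ) [ u≢0 , ≯ ]′)

  exit-below : ∀ {u} → u ≢ 0 → u + δ < p → exit u ≡ y
  exit-below u≢0 lt = exit-≯ u≢0 (<-asym lt)

  exit-at : ∀ {u} → u ≢ 0 → u + δ ≡ p → exit u ≡ y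
  exit-at u≢0 eq = exit-≯ u≢0 (<-irrefl (sym eq))

  exit-next : ∀ {u} → u < p → exit ((u + 1) % p) ≢ entry u
  exit-next {u} u<p = go (m≤n⇒m<n∨m≡n (subst (_≤ p) (+-comm 1 u) u<p)) (u + δ <? p)
    where
    distinct : ∀ {a b c d : Fin n} → a ≡ c → b ≡ d → c ≢ d → a ≢ b
    distinct refl refl c≢d = c≢d
    w+δ≡ : u + 1 < p → (u + 1) % p + δ ≡ suc (u + δ)
    w+δ≡ u+1<p = trans (cong (_+ δ) (m<n⇒m%n≡m u+1<p)) (trans (+-assoc u 1 δ) (+-suc u δ))
    go : u + 1 < p ⊎ u + 1 ≡ p → Dec (u + δ < p) → exit ((u + 1) % p) ≢ entry u
    go (inj₂ u+1≡p) _ = distinct (exit-zero (trans (cong (_% p) u+1≡p) (n%n≡0 p)))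
                                 (entry-≮ λ lt → <⇒≱ lt (subst (_≤ u + δ) u+1≡p (+-monoʳ-≤ u (s≤s z≤n))))
                                 x≢y
    go (inj₁ u+1<p) (yes lt) = distinct (exit-≯ w≢0 λ gt → <⇒≱ gt (subst (_≤ p) (sym (w+δ≡ u+1<p)) lt))
                                        (entry-below lt) y≢x
      where
      w≢0 : (u + 1) % p ≢ 0
      w≢0 eq = 1+n≢0 (trans (+-comm 1 u) (trans (sym (m<n⇒m%n≡m u+1<p)) eq))
    go (inj₁ u+1<p) (no ≮)   = distinct (exit-above (subst (p <_) (sym (w+δ≡ u+1<p)) (s≤s (≮⇒≥ ≮))))
                                        (entry-≮ ≮) x≢y

  below-< : ∀ {u v} → v ≡ u + δ → u < v
  below-< {u} v≡u+δ = subst (u <_) (sym v≡u+δ) (m<m+n u (s≤s z≤n))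

  below-≢0 : ∀ {u v} → v ≡ u + δ → v ≢ 0
  below-≢0 v≡u+δ v≡0 = <⇒≢ (≤-<-trans z≤n (below-< v≡u+δ)) (sym v≡0)

  above-≢0 : ∀ {u v} → p < u + δ → v + p ≡ u + δ → v ≢ 0
  above-≢0 gt v+p≡u+δ v≡0 = <-irrefl (trans (cong (_+ p) (sym v≡0)) v+p≡u+δ) gt

  above-≤ : ∀ {u v} → v + p ≡ u + δ → v ≤ u
  above-≤ {u} {v} v+p≡u+δ = +-cancelʳ-≤ p v u (subst (_≤ u + p) (sym v+p≡u+δ) (+-monoʳ-≤ u δ≤p))

  above-<δ : ∀ {u v} → u < p → v + p ≡ u + δ → v < δ
  above-<δ {u} {v} u<p v+p≡u+δ =
    +-cancelʳ-< p v δ (subst₂ _<_ (sym v+p≡u+δ) (+-comm p δ) (+-monoˡ-< δ u<p))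

  CellEnds : ℕ → Order → ℕ → Set
  CellEnds α o r = ends (restrict (cell α o r)) ≡ entry (sx r) ⋯ exit (sx r)

  cell-ends : ∀ α o r {L M} → buckets α r ≡ L → sweptPair α o r ≡ M →
              ends (restrict (cell α o r)) ≡ ends (L ++ M)
  cell-ends α o r B≡L S≡M = cong ends (trans (restrict-cell α o r) (cong₂ _++_ B≡L S≡M))

  cell-⋯ : ∀ α o r {L M a b} → buckets α r ≡ L → sweptPair α o r ≡ M → ends (L ++ M) ≡ a ⋯ b →
           entry (sx r) ≡ a → exit (sx r) ≡ b → CellEnds α o r
  cell-⋯ α o r B≡L S≡M E refl refl = trans (cell-ends α o r B≡L S≡M) E

  cell-unswept : ∀ α o r → sx r ≢ 0 → sx r < α → CellEnds α o r
  cell-unswept α o r u≢0 u<α with wrap r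
  ... | below lt v≡u+δ with sy r <? α
  ...   | yes v<α = cell-⋯ α o r (buckets-xy (below-< v≡u+δ) v<α)
                           (swept-none o (unswept u≢0 u<α) (unswept (below-≢0 v≡u+δ) v<α))
                           ends-xy (entry-below lt) (exit-below u≢0 lt)
  ...   | no v≮α  = cell-⋯ α o r (buckets-x u<α (≮⇒≥ v≮α))
                           (swept-y o (unswept u≢0 u<α) (inj₂ (≮⇒≥ v≮α)))
                           ends-xy (entry-below lt) (exit-below u≢0 lt)
  cell-unswept α o r u≢0 u<α | at eq v≡0 =
    cell-⋯ α o r (buckets-yx (subst (_≤ sx r) (sym v≡0) z≤n) u<α)
                 (swept-y o (unswept u≢0 u<α) (inj₁ v≡0))
           ends-yxy (entry-at eq) (exit-at u≢0 eq)
  cell-unswept α o r u≢0 u<α | above gt v+p≡u+δ =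
    cell-⋯ α o r (buckets-yx v≤u u<α)
                 (swept-none o (unswept u≢0 u<α) (unswept (above-≢0 gt v+p≡u+δ) (≤-<-trans v≤u u<α)))
           ends-yx (entry-above gt) (exit-above gt)
    where v≤u = above-≤ v+p≡u+δ

  cell↑ : ∀ {α} → α ≤ p → δ < α → ∀ r → CellEnds α ↑ r
  cell↑ {α} α≤p δ<α r with swept? α (sx r)
  ... | no u∉ = cell-unswept α ↑ r (u∉ ∘ inj₁) (≰⇒> (u∉ ∘ inj₂))
  ... | yes (inj₁ u≡0) with wrap r
  ...   | below lt v≡u+δ = cell-⋯ α ↑ r (buckets-xy (below-< v≡u+δ) v<α)
                                  (swept-x ↑ (inj₁ u≡0) (unswept (below-≢0 v≡u+δ) v<α))
                                  ends-xyx (entry-below lt) (exit-zero u≡0)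
    where v<α = subst (_< α) (sym (trans v≡u+δ (cong (_+ δ) u≡0))) δ<α
  ...   | at eq _        = ⊥-elim (<-irrefl (trans (sym (cong (_+ δ) u≡0)) eq) (<-≤-trans δ<α α≤p))
  ...   | above gt _     = ⊥-elim (<⇒≱ gt (subst (_≤ p) (sym (cong (_+ δ) u≡0)) δ≤p))
  cell↑ {α} α≤p δ<α r | yes (inj₂ α≤u) with wrap r
  ... | below lt v≡u+δ = cell-⋯ α ↑ r (buckets-none α≤u α≤v)
                                (swept-both ↑ (inj₂ α≤u) (inj₂ α≤v))
                                ends-xy (entry-below lt) (exit-below u≢0 lt)
    where
    α≤v = ≤-trans α≤u (<⇒≤ (below-< v≡u+δ))
    u≢0 = λ u≡0 → <⇒≱ (≤-<-trans z≤n δ<α) (subst (α ≤_) u≡0 α≤u)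
  ... | at eq v≡0      = cell-⋯ α ↑ r (buckets-y (subst (_< α) (sym v≡0) (≤-<-trans z≤n δ<α)) α≤u)
                                (swept-both ↑ (inj₂ α≤u) (inj₁ v≡0))
                                ends-yxy (entry-at eq) (exit-at u≢0 eq)
    where u≢0 = λ u≡0 → <⇒≱ (≤-<-trans z≤n δ<α) (subst (α ≤_) u≡0 α≤u)
  ... | above gt v+p≡u+δ = cell-⋯ α ↑ r (buckets-y v<α α≤u)
                                  (swept-x ↑ (inj₂ α≤u) (unswept (above-≢0 gt v+p≡u+δ) v<α))
                                  ends-yx (entry-above gt) (exit-above gt)
    where v<α = <-trans (above-<δ (m%n<n _ p) v+p≡u+δ) δ<α

  cell↓ : ∀ {α} → 1 ≤ α → p < α + δ → ∀ r → CellEnds α ↓ r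
  cell↓ {α} 1≤α p<α+δ r with swept? α (sx r)
  ... | no u∉ = cell-unswept α ↓ r (u∉ ∘ inj₁) (≰⇒> (u∉ ∘ inj₂))
  ... | yes (inj₁ u≡0) with wrap r
  ...   | below lt v≡u+δ with δ <? α
  ...     | yes δ<α = cell-⋯ α ↓ r (buckets-xy (below-< v≡u+δ) v<α)
                                   (swept-x ↓ (inj₁ u≡0) (unswept (below-≢0 v≡u+δ) v<α))
                                   ends-xyx (entry-below lt) (exit-zero u≡0)
    where v<α = subst (_< α) (sym (trans v≡u+δ (cong (_+ δ) u≡0))) δ<α
  ...     | no δ≮α  = cell-⋯ α ↓ r (buckets-x (subst (_< α) (sym u≡0) 1≤α) α≤v)
                                   (swept-both ↓ (inj₁ u≡0) (inj₂ α≤v))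
                                   ends-xyx (entry-below lt) (exit-zero u≡0)
    where α≤v = subst (α ≤_) (sym (trans v≡u+δ (cong (_+ δ) u≡0))) (≮⇒≥ δ≮α)
  cell↓ {α} 1≤α p<α+δ r | yes (inj₁ u≡0) | at eq v≡0 =
    cell-⋯ α ↓ r (buckets-yx (subst₂ _≤_ (sym v≡0) (sym u≡0) z≤n) (subst (_< α) (sym u≡0) 1≤α))
                 (swept-both ↓ (inj₁ u≡0) (inj₁ v≡0))
                 ends-yxyx (entry-at eq) (exit-zero u≡0)
  cell↓ {α} 1≤α p<α+δ r | yes (inj₁ u≡0) | above gt _ =
    ⊥-elim (<⇒≱ gt (subst (_≤ p) (sym (cong (_+ δ) u≡0)) δ≤p))
  cell↓ {α} 1≤α p<α+δ r | yes (inj₂ α≤u) with wrap r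
  ... | below lt _   = ⊥-elim (<-asym p<α+δ (≤-<-trans (+-monoˡ-≤ δ α≤u) lt))
  ... | at eq _      = ⊥-elim (<⇒≱ p<α+δ (subst (α + δ ≤_) eq (+-monoˡ-≤ δ α≤u)))
  ... | above gt v+p≡u+δ with sy r <? α
  ...   | yes v<α = cell-⋯ α ↓ r (buckets-y v<α α≤u)
                                 (swept-x ↓ (inj₂ α≤u) (unswept (above-≢0 gt v+p≡u+δ) v<α))
                                 ends-yx (entry-above gt) (exit-above gt)
  ...   | no v≮α  = cell-⋯ α ↓ r (buckets-none α≤u (≮⇒≥ v≮α))
                                 (swept-both ↓ (inj₂ α≤u) (inj₂ (≮⇒≥ v≮α)))
                                 ends-yx (entry-above gt) (exit-above gt)

  cell↑-clash : ∀ {α r} → 1 ≤ α → α ≤ δ → sx r ≡ 0 → ends (restrict (cell α ↑ r)) ≡ clash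
  cell↑-clash {α} {r} 1≤α α≤δ u≡0 with wrap r
  ... | below _ v≡u+δ = trans (cell-ends α ↑ r (buckets-x u<α α≤v)
                                               (swept-both ↑ (inj₁ u≡0) (inj₂ α≤v)))
                              (ends-∷-≡ x [ y ])
    where
    u<α = subst (_< α) (sym u≡0) 1≤α
    α≤v = subst (α ≤_) (sym (trans v≡u+δ (cong (_+ δ) u≡0))) α≤δ
  ... | at _ v≡0      = trans (cell-ends α ↑ r (buckets-yx (subst₂ _≤_ (sym v≡0) (sym u≡0) z≤n)
                                                           (subst (_< α) (sym u≡0) 1≤α))
                                               (swept-both ↑ (inj₁ u≡0) (inj₁ v≡0)))
                              ends-yxxy
  ... | above gt _    = ⊥-elim (<⇒≱ gt (subst (_≤ p) (sym (cong (_+ δ) u≡0)) δ≤p))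

  cell↓-clash : ∀ {α r} → 1 ≤ α → α + δ ≤ p → sy r ≡ 0 → ends (restrict (cell α ↓ r)) ≡ clash
  cell↓-clash {α} {r} 1≤α α+δ≤p v≡0 with wrap r
  ... | below _ v≡u+δ  = ⊥-elim (below-≢0 v≡u+δ v≡0)
  ... | at eq _        = trans (cell-ends α ↓ r (buckets-y (subst (_< α) (sym v≡0) 1≤α) α≤u)
                                                (swept-both ↓ (inj₂ α≤u) (inj₁ v≡0)))
                               (ends-∷-≡ y [ x ])
    where α≤u = +-cancelʳ-≤ δ α (sx r) (subst (α + δ ≤_) (sym eq) α+δ≤p)
  ... | above gt v+p≡u+δ = ⊥-elim (above-≢0 gt v+p≡u+δ v≡0)

  ends-restrict-word : ∀ α o →
                       ends (restrict (word α o)) ≡ ⨁ (map (ends ∘ restrict ∘ cell α o) (downFrom p))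
  ends-restrict-word α o = trans (cong ends (filter-concatMap (pair? x y) (cell α o) (downFrom p)))
                                 (ends-concatMap (restrict ∘ cell α o) (downFrom p))

  WordEnds : ℕ → Order → Set
  WordEnds α o = ends (restrict (word α o)) ≡ entry (sx (pred p)) ⋯ exit (sx 0)

  word-ends : ∀ α o → (∀ r → CellEnds α o r) → WordEnds α o
  word-ends α o cells = begin
    ends (restrict (word α o))                     ≡⟨ ends-restrict-word α o ⟩
    ⨁ (map S (downFrom p))                         ≡⟨ cong (λ q → ⨁ (map S (downFrom q))) (sym (suc-pred p)) ⟩
    ⨁ (map S (downFrom (suc (pred p))))            ≡⟨ ⨁-downFrom-⋯ (pred p) cells junction ⟩
    entry (sx (pred p)) ⋯ exit (sx 0)              ∎
    where
    open ≡-Reasoning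
    S = ends ∘ restrict ∘ cell α o
    junction : ∀ r → exit (sx (suc r)) ≢ entry (sx r)
    junction r = subst (λ w → exit w ≢ entry (sx r)) (sym (slot-suc r x)) (exit-next (m%n<n _ p))

  word-clash : ∀ α o {r} → r < p → ends (restrict (cell α o r)) ≡ clash → ends (restrict (word α o)) ≡ clash
  word-clash α o r<p cell≡clash = trans (ends-restrict-word α o) (⨁-downFrom-clash p r<p cell≡clash)

  word↑-ends : ∀ {α} → α ≤ p → δ < α → WordEnds α ↑
  word↑-ends {α} α≤p δ<α = word-ends α ↑ (cell↑ α≤p δ<α)

  word↓-ends : ∀ {α} → 1 ≤ α → p < α + δ → WordEnds α ↓
  word↓-ends {α} 1≤α p<α+δ = word-ends α ↓ (cell↓ 1≤α p<α+δ)

  word↑-clash : ∀ {α} → 1 ≤ α → α ≤ δ → ends (restrict (word α ↑)) ≡ clash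
  word↑-clash {α} 1≤α α≤δ with ∃-complement-mod (toℕ x)
  ... | r , r<p , sx≡0 = word-clash α ↑ r<p (cell↑-clash {r = r} 1≤α α≤δ sx≡0)

  word↓-clash : ∀ {α} → 1 ≤ α → α + δ ≤ p → ends (restrict (word α ↓)) ≡ clash
  word↓-clash {α} 1≤α α+δ≤p with ∃-complement-mod (toℕ y)
  ... | r , r<p , sy≡0 = word-clash α ↓ r<p (cell↓-clash {r = r} 1≤α α+δ≤p sy≡0)

  words-junction : exit (sx 0) ≢ entry (sx (pred p))
  words-junction = subst (λ w → exit w ≢ entry (sx (pred p))) (sym (slot-zero x)) (exit-next (m%n<n _ p))

  ends-restrict-++ : ∀ v w → ends (restrict (v ++ w)) ≡ ends (restrict v) ⊕ ends (restrict w)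
  ends-restrict-++ v w = trans (cong ends (filter-++ (pair? x y) v w)) (ends-++ (restrict v) (restrict w))

InBlock : ℕ → ℕ → ℕ → Set
InBlock k l t = k ≤ t × t < k + l

inBlock? : ∀ k l t → Dec (InBlock k l t)
inBlock? k l t = k ≤? t ×-dec t <? k + l

T-block : ∀ k l m i → T (block k l m i) ⇔ InBlock k l (toℕ i)
T-block k l m i = mk⇔
  (λ t → let (k≤i , i<k+l) = Equivalence.to T-∧ t
         in ≤ᵇ⇒≤ k (toℕ i) k≤i , <ᵇ⇒< (toℕ i) (k + l) i<k+l)
  (λ (k≤i , i<k+l) → Equivalence.from T-∧ (≤⇒≤ᵇ k≤i , <⇒<ᵇ i<k+l))

adjacency : ∀ k l m (h : 1 ≤ k + l + m) n (x y : Fin n) →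
            toeplitz (k + l + m) h (block k l m) n x y ⇔ InBlock k l (residue (k + l + m) {{>-nonZero h}} x y)
adjacency k l m h n x y =
  subst (λ t → T (block k l m i) ⇔ InBlock k l t) (toℕ-fromℕ< i<p) (T-block k l m i)
  where
  i<p = m%n<n (∣ toℕ x - toℕ y ∣ ∸ 1) (k + l + m) {{>-nonZero h}}
  i = fromℕ< i<p

blockWord : (k l m : ℕ) → 1 ≤ k + l + m → (n : ℕ) → List (Fin n)
blockWord k l       (suc m) h n = word (suc (k + l)) ↑ ++ word (l + suc m) ↓
  where open Construction n (k + l + suc m) {{>-nonZero h}}
blockWord k (suc l) zero    h n = word (suc l) ↓
  where open Construction n (k + suc l + zero) {{>-nonZero h}}
blockWord k zero    zero    h n = word 1 ↑
  where open Construction n (k + zero + zero) {{>-nonZero h}}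

blockWord-represents< : ∀ k l m (h : 1 ≤ k + l + m) n {x y : Fin n} → toℕ x < toℕ y →
                        Alternate (blockWord k l m h n) x y ⇔
                        InBlock k l (residue (k + l + m) {{>-nonZero h}} x y)
blockWord-represents< k l (suc m) h n {x} {y} x<y =
  alternating⇔ (restrict (w↑ ++ w↓)) (inBlock? k l t) inside outside
  where
  instance _ = >-nonZero h
  open Construction n (k + l + suc m) using (word)
  open Pair {p = k + l + suc m} x<y
  open Alternation (_≟_ {n})
  t = residue (k + l + suc m) x y
  α = l + suc m
  w↑ = word (suc (k + l)) ↑
  w↓ = word α ↓
  p≡k+α : k + l + suc m ≡ k + α
  p≡k+α = +-assoc k l (suc m)
  1≤α : 1 ≤ α
  1≤α = subst (1 ≤_) (sym (+-suc l m)) (s≤s z≤n)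
  inside : InBlock k l t → ∃[ a ] ∃[ b ] ends (restrict (w↑ ++ w↓)) ≡ a ⋯ b
  inside (k≤t , t<k+l) = _ , _ , (begin
    ends (restrict (w↑ ++ w↓))              ≡⟨ ends-restrict-++ w↑ w↓ ⟩
    ends (restrict w↑) ⊕ ends (restrict w↓) ≡⟨ cong₂ _⊕_ (word↑-ends (m<m+n (k + l) (s≤s z≤n)) (s≤s t<k+l))
                                                         (word↓-ends 1≤α p<α+δ) ⟩
    (first ⋯ last) ⊕ (first ⋯ last)         ≡⟨ ⋯⊕⋯-≢ words-junction ⟩
    first ⋯ last                            ∎)
    where
    open ≡-Reasoning
    first = entry (sx (pred (k + l + suc m)))
    last  = exit (sx 0)
    p<α+δ = subst (_< α + δ) (sym p≡k+α) (m<n⇒m+o<o+n α (s≤s k≤t))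
  outside : ¬ InBlock k l t → ends (restrict (w↑ ++ w↓)) ≡ clash
  outside ∉ with k ≤? t
  ... | no k≰t  = trans (ends-restrict-++ w↑ w↓)
                    (trans (cong (ends (restrict w↑) ⊕_) (word↓-clash 1≤α α+δ≤p))
                           (⊕-zeroʳ (ends (restrict w↑))))
    where α+δ≤p = subst (α + δ ≤_) (sym p≡k+α) (m≤n⇒o+m≤n+o α (≰⇒> k≰t))
  ... | yes k≤t = trans (ends-restrict-++ w↑ w↓)
                    (cong (_⊕ ends (restrict w↓))
                          (word↑-clash (s≤s z≤n) (s≤s (≮⇒≥ (∉ ∘ (k≤t ,_))))))
blockWord-represents< k (suc l) zero h n {x} {y} x<y =
  alternating⇔ (restrict (word α ↓)) (inBlock? k (suc l) t) inside outside
  where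
  instance _ = >-nonZero h
  open Construction n (k + suc l + zero) using (word)
  open Pair {p = k + suc l + zero} x<y
  open Alternation (_≟_ {n})
  t = residue (k + suc l + zero) x y
  α = suc l
  p≡k+α : k + suc l + zero ≡ k + α
  p≡k+α = +-identityʳ (k + α)
  inside : InBlock k (suc l) t → ∃[ a ] ∃[ b ] ends (restrict (word α ↓)) ≡ a ⋯ b
  inside (k≤t , _) =
    _ , _ , word↓-ends (s≤s z≤n) (subst (_< α + δ) (sym p≡k+α) (m<n⇒m+o<o+n α (s≤s k≤t)))
  outside : ¬ InBlock k (suc l) t → ends (restrict (word α ↓)) ≡ clash
  outside ∉ = word↓-clash (s≤s z≤n) (subst (α + δ ≤_) (sym p≡k+α) (m≤n⇒o+m≤n+o α t<k))
    where t<k = ≰⇒> λ k≤t → ∉ (k≤t , subst (t <_) p≡k+α (m%n<n _ (k + suc l + zero)))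
blockWord-represents< k zero zero h n {x} {y} x<y =
  alternating⇔ (restrict (word 1 ↑)) (inBlock? k zero t) inside outside
  where
  instance _ = >-nonZero h
  open Construction n (k + zero + zero) using (word)
  open Pair {p = k + zero + zero} x<y
  open Alternation (_≟_ {n})
  t = residue (k + zero + zero) x y
  inside : InBlock k zero t → ∃[ a ] ∃[ b ] ends (restrict (word 1 ↑)) ≡ a ⋯ b
  inside (k≤t , t<k+0) = ⊥-elim (<⇒≱ (subst (t <_) (+-identityʳ k) t<k+0) k≤t)
  outside : ¬ InBlock k zero t → ends (restrict (word 1 ↑)) ≡ clash
  outside _ = word↑-clash (s≤s z≤n) (s≤s z≤n)

residue-comm : ∀ p .{{_ : NonZero p}} {n} (x y : Fin n) → residue p x y ≡ residue p y x
residue-comm p x y = cong (λ d → (d ∸ 1) % p) (∣-∣-comm (toℕ x) (toℕ y))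

Alternate-comm : ∀ {n} (w : List (Fin n)) x y → Alternate w x y ≡ Alternate w y x
Alternate-comm w x y =
  cong (Linked _≢_) (filter-does-cong (pair? x y) (pair? y x) (λ z → ∨-comm (does (z ≟ x)) (does (z ≟ y))) w)

blockWord-represents : ∀ k l m (h : 1 ≤ k + l + m) n {x y : Fin n} → x ≢ y →
                       Alternate (blockWord k l m h n) x y ⇔
                       InBlock k l (residue (k + l + m) {{>-nonZero h}} x y)
blockWord-represents k l m h n {x} {y} x≢y with <-cmp (toℕ x) (toℕ y)
... | tri< x<y _ _ = blockWord-represents< k l m h n x<y
... | tri≈ _ x≡y _ = ⊥-elim (x≢y (toℕ-injective x≡y))
... | tri> _ _ y<x = subst₂ _⇔_ (Alternate-comm (blockWord k l m h n) y x)
                              (cong (InBlock k l) (residue-comm (k + l + m) {{>-nonZero h}} y x))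
                              (blockWord-represents< k l m h n y<x)

theorem4 : (k l m : ℕ) → (h : 1 ≤ k + l + m) → (n : ℕ) → 1 ≤ n →
    WordRepresentable (toeplitz (k + l + m) h (block k l m) n)
theorem4 k l m h n _ = blockWord k l m h n , λ x y x≢y →
  ⇔-sym (adjacency k l m h n x y) ⇔-∘ blockWord-represents k l m h n x≢y
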